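{- Consider an execution of $\mathtt{GlobalAlg}(G,\widetilde\Delta)$ on a graph $G=(V,E)$ whose maximum degree is at most $\widetilde\Delta$, and any one phase of it. Let $H$ be the set of heavy vertices selected in that phase. Then the set $F$ of friends created in the same phase satisfies $\mathbb{E}[|F|] \le \frac{1}{4}|H|$.
   Context: For a vertex $v$, $N(v)$ is its set of neighbors in $G$; $G[U]$ is the subgraph induced by $U$. $\mathtt{GlobalAlg}(G,\widetilde\Delta)$: set $\Delta\leftarrow\widetilde\Delta$, $M\leftarrow\emptyset$, $V'\leftarrow V$. While $\Delta\ge 1$ (each iteration is a phase; invariant: the maximum degree of $G[V']$ is at most $\Delta$): (1) let $H\subseteq V'$ be the set of vertices of degree at least $\Delta/2$ in $G[V']$ (heavy vertices); (2) create a set $F$ (friends) by including each $v\in V'$ independently with probability $|N(v)\cap H|/(4\Delta)$; (3) compute a matching $\widetilde M=\mathtt{MatchHeavy}(H,F)$ in $G[H\cup F]$ and add it to $M$; (4) set $V'\leftarrow V'\setminus(H\cup F)$ and $\Delta\leftarrow\Delta/2$. Return $M$. $\mathtt{MatchHeavy}(H,F)$: each $v\in F$ picks a uniformly random $v_\star\in N(v)\cap H$; each vertex of $H\cup F$ is independently colored red or blue; $E_\star=\{(v,v_\star): v\in F \text{ red}, v_\star \text{ blue}\}$; for every blue vertex incident to an edge in $E_\star$ one such edge is added to the returned matching. -}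

module Defs where

open import Data.Bool using (Bool; true; false; _∧_; if_then_else_)
open import Data.Nat as ℕ using (ℕ; zero; suc)
open import Data.Integer using (+_)
open import Data.Fin as Fin using (Fin)
open import Data.Fin.Subset using (Subset; _∈_; _∩_; ∣_∣)
open import Data.Vec using (Vec; []; _∷_; lookup; tabulate; map)
open import Data.List using (List; []; _∷_; _++_) renaming (map to lmap; foldr to lfoldr)
open import Data.Rational using (ℚ; 0ℚ; 1ℚ; ½; _+_; _*_; _-_; _÷_; _/_; _≤_; _≤ᵇ_; _<_; >-nonZero)
open import Data.Rational.Properties using (<-≤-trans; positive⁻¹)
open import Relation.Binary.PropositionalEquality using (_≡_)

toℚ : ℕ → ℚ
toℚ n = + n / 1

record Graph (n : ℕ) : Set where
  field
    adj   : Fin n → Fin n → Bool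
    sym   : ∀ u v → adj u v ≡ adj v u
    irrefl : ∀ v → adj v v ≡ false

open Graph public

N : ∀ {n} → Graph n → Fin n → Subset n
N G v = tabulate (adj G v)

degIn : ∀ {n} → Graph n → Subset n → Fin n → ℕ
degIn G U v = ∣ N G v ∩ U ∣

MaxDegAtMost : ∀ {n} → Graph n → ℕ → Set
MaxDegAtMost G D = ∀ v → ∣ N G v ∣ ℕ.≤ D

InducedMaxDegAtMost : ∀ {n} → Graph n → Subset n → ℚ → Set
InducedMaxDegAtMost G V' Δ = ∀ v → v ∈ V' → toℚ (degIn G V' v) ≤ Δ

-- value of Δ in phase k (0-based) of GlobalAlg(G, Δ̃): Δ̃ / 2^k
phaseΔ : ℕ → ℕ → ℚ
phaseΔ Δ̃ zero = toℚ Δ̃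
phaseΔ Δ̃ (suc k) = phaseΔ Δ̃ k * ½

Heavy : ∀ {n} → Graph n → Subset n → ℚ → Subset n
Heavy G V' Δ = tabulate λ v → lookup V' v ∧ (Δ * ½ ≤ᵇ toℚ (degIn G V' v))

-- probability that v is put into F:  |N(v) ∩ H| / (4Δ) for v ∈ V', 0 otherwise
-- (Δ ≥ 1 is needed to divide by 4Δ)
friendProb : ∀ {n} → Graph n → Subset n → (Δ : ℚ) → 1ℚ ≤ Δ → Fin n → ℚ
friendProb G V' Δ 1≤Δ v =
  if lookup V' v
  then _÷_ (+ ∣ N G v ∩ Heavy G V' Δ ∣ / 4) Δ {{>-nonZero (<-≤-trans (positive⁻¹ 1ℚ) 1≤Δ)}}
  else 0ℚ

allSubsets : ∀ n → List (Subset n)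
allSubsets zero = [] ∷ []
allSubsets (suc n) = lmap (true ∷_) (allSubsets n) ++ lmap (false ∷_) (allSubsets n)

-- probability of the outcome S when each v is included independently with prob. p v
prodProb : ∀ {n} → (Fin n → ℚ) → Subset n → ℚ
prodProb p [] = 1ℚ
prodProb p (b ∷ S) =
  (if b then p Fin.zero else 1ℚ - p Fin.zero) * prodProb (λ i → p (Fin.suc i)) S

expect : ∀ {n} → (Fin n → ℚ) → (Subset n → ℚ) → ℚ
expect {n} p X = lfoldr _+_ 0ℚ (lmap (λ S → prodProb p S * X S) (allSubsets n))

expectedFriends : ∀ {n} → Graph n → Subset n → (Δ : ℚ) → 1ℚ ≤ Δ → ℚ
expectedFriends G V' Δ 1≤Δ = expect (friendProb G V' Δ 1≤Δ) (λ F → toℚ ∣ F ∣)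

-- By linearity of expectation, E|F| is the sum over v ∈ V' of |N(v) ∩ H| / 4Δ,
-- whose numerator counts the edges between V' and H. Counted from the H side,
-- every heavy vertex has at most Δ neighbours in V', so there are at most |H|Δ.

module Submission where

open import Defs hiding (sym)
open import Data.Bool using (Bool; true; false; if_then_else_)
open import Data.Bool.Properties using (∧-conicalˡ)
open import Data.Nat using (ℕ; zero; suc)
  renaming (_+_ to _+ℕ_; _*_ to _*ℕ_)
import Data.Nat.Properties as ℕ
open import Data.Integer as ℤ using (+_)
import Data.Integer.Properties as ℤ
open import Data.Fin using (Fin)
open import Data.Fin.Subset using (Subset; _∈_; _⊆_; _∩_; ∣_∣)
open import Data.Vec using ([]; _∷_; lookup; tabulate; here; there)
open import Data.Vec.Properties using (lookup∘tabulate; lookup⇒[]=; []=⇒lookup)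
open import Data.List using (List; []; _∷_; _++_; map; foldr)
open import Data.List.Properties using (map-∘)
open import Data.Rational
  using (ℚ; 0ℚ; 1ℚ; _+_; _*_; _-_; _÷_; _/_; _≤_; 1/_; NonZero; Positive; NonNegative; positive; toℚᵘ)
open import Data.Rational.Properties
  using ( +-identityˡ; +-identityʳ; +-assoc; *-identityˡ; *-identityʳ; *-assoc
        ; *-zeroˡ; *-zeroʳ; *-distribˡ-+; *-distribʳ-+; *-inverseʳ; +-*-commutativeRing
        ; ≤-reflexive; <-≤-trans; +-mono-≤; *-monoʳ-≤-nonNeg; module ≤-Reasoning
        ; positive⁻¹; pos⇒nonZero; pos⇒nonNeg; 1/pos⇒pos; nonNeg*nonNeg⇒nonNeg
        ; toℚᵘ-injective; toℚᵘ-fromℚᵘ; toℚᵘ-homo-+; toℚᵘ-homo-* )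
import Data.Rational.Unnormalised.Base as ℚᵘ
import Data.Rational.Unnormalised.Properties as ℚᵘ
open import Data.Rational.Solver using (module +-*-Solver)
import Algebra.Bundles
import Algebra.Properties.Semiring.Sum as SemiringSum
open import Function using (_∘_)
open import Relation.Binary.PropositionalEquality

open SemiringSum ℕ.+-*-semiring using (sum; sum-syntax; ∑-comm; sum-cong-≗; *-distribˡ-sum)
module ℚΣ = SemiringSum (Algebra.Bundles.CommutativeRing.semiring +-*-commutativeRing)

-- `_/_` normalises by a gcd that does not reduce on variables, so identities
-- about toℚ are proved in ℚᵘ and transported back by toℚᵘ-injective.
toℚᵘ-/ : ∀ i d-1 → toℚᵘ (i / suc d-1) ℚᵘ.≃ ℚᵘ.mkℚᵘ i d-1
toℚᵘ-/ i d-1 = toℚᵘ-fromℚᵘ (ℚᵘ.mkℚᵘ i d-1)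

toℚ-+ : ∀ m n → toℚ (m +ℕ n) ≡ toℚ m + toℚ n
toℚ-+ m n = toℚᵘ-injective (begin-equality
  toℚᵘ (toℚ (m +ℕ n))                      ≃⟨ toℚᵘ-/ (+ (m +ℕ n)) 0 ⟩
  ℚᵘ.mkℚᵘ (+ (m +ℕ n)) 0                   ≃⟨ ℚᵘ.*≡* cross ⟩
  ℚᵘ.mkℚᵘ (+ m) 0 ℚᵘ.+ ℚᵘ.mkℚᵘ (+ n) 0     ≃⟨ ℚᵘ.+-cong (toℚᵘ-/ (+ m) 0) (toℚᵘ-/ (+ n) 0) ⟨
  toℚᵘ (toℚ m) ℚᵘ.+ toℚᵘ (toℚ n)           ≃⟨ toℚᵘ-homo-+ (toℚ m) (toℚ n) ⟨
  toℚᵘ (toℚ m + toℚ n)                     ∎)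
  where
  open ℚᵘ.≤-Reasoning
  cross : + (m +ℕ n) ℤ.* + 1 ≡ (+ m ℤ.* + 1 ℤ.+ + n ℤ.* + 1) ℤ.* + 1
  cross = cong (ℤ._* + 1) (trans (ℤ.pos-+ m n)
    (sym (cong₂ ℤ._+_ (ℤ.*-identityʳ (+ m)) (ℤ.*-identityʳ (+ n)))))

/4≡toℚ*¼ : ∀ n → + n / 4 ≡ toℚ n * (+ 1 / 4)
/4≡toℚ*¼ n = toℚᵘ-injective (begin-equality
  toℚᵘ (+ n / 4)                           ≃⟨ toℚᵘ-/ (+ n) 3 ⟩
  ℚᵘ.mkℚᵘ (+ n) 3                          ≃⟨ ℚᵘ.*≡* cross ⟩
  ℚᵘ.mkℚᵘ (+ n) 0 ℚᵘ.* ℚᵘ.mkℚᵘ (+ 1) 3     ≃⟨ ℚᵘ.*-cong (toℚᵘ-/ (+ n) 0) (toℚᵘ-/ (+ 1) 3) ⟨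
  toℚᵘ (toℚ n) ℚᵘ.* toℚᵘ (+ 1 / 4)         ≃⟨ toℚᵘ-homo-* (toℚ n) (+ 1 / 4) ⟨
  toℚᵘ (toℚ n * (+ 1 / 4))                 ∎)
  where
  open ℚᵘ.≤-Reasoning
  cross : + n ℤ.* + 4 ≡ (+ n ℤ.* + 1) ℤ.* + 4
  cross rewrite ℤ.*-identityʳ (+ n) = refl

toℚ-sum : ∀ {n} (f : Fin n → ℕ) → toℚ (sum f) ≡ ℚΣ.sum (toℚ ∘ f)
toℚ-sum {zero}  f = refl
toℚ-sum {suc n} f =
  trans (toℚ-+ (f Fin.zero) _) (cong (_+_ (toℚ (f Fin.zero))) (toℚ-sum (f ∘ Fin.suc)))

∑ˡ : {A : Set} → List A → (A → ℚ) → ℚ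
∑ˡ xs f = foldr _+_ 0ℚ (map f xs)

module _ {A : Set} where

  ∑ˡ-++ : ∀ (xs ys : List A) f → ∑ˡ (xs ++ ys) f ≡ ∑ˡ xs f + ∑ˡ ys f
  ∑ˡ-++ []       ys f = sym (+-identityˡ _)
  ∑ˡ-++ (x ∷ xs) ys f = trans (cong (_+_ (f x)) (∑ˡ-++ xs ys f)) (sym (+-assoc (f x) _ _))

  ∑ˡ-map : ∀ {B : Set} (g : A → B) xs f → ∑ˡ (map g xs) f ≡ ∑ˡ xs (f ∘ g)
  ∑ˡ-map g xs f = cong (foldr _+_ 0ℚ) (sym (map-∘ xs))

  ∑ˡ-cong : ∀ (xs : List A) {f g} → (∀ x → f x ≡ g x) → ∑ˡ xs f ≡ ∑ˡ xs g
  ∑ˡ-cong []       f≗g = refl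
  ∑ˡ-cong (x ∷ xs) f≗g = cong₂ _+_ (f≗g x) (∑ˡ-cong xs f≗g)

  *-distribˡ-∑ˡ : ∀ c (xs : List A) f → c * ∑ˡ xs f ≡ ∑ˡ xs (λ x → c * f x)
  *-distribˡ-∑ˡ c []       f = *-zeroʳ c
  *-distribˡ-∑ˡ c (x ∷ xs) f =
    trans (*-distribˡ-+ c (f x) _) (cong (_+_ (c * f x)) (*-distribˡ-∑ˡ c xs f))

  ∑ˡ-distrib-+ : ∀ (xs : List A) f g → ∑ˡ xs (λ x → f x + g x) ≡ ∑ˡ xs f + ∑ˡ xs g
  ∑ˡ-distrib-+ []       f g = refl
  ∑ˡ-distrib-+ (x ∷ xs) f g =
    trans (cong (_+_ (f x + g x)) (∑ˡ-distrib-+ xs f g)) (interchange (f x) (g x) _ _)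
    where
    open +-*-Solver
    interchange : ∀ a b c d → (a + b) + (c + d) ≡ (a + c) + (b + d)
    interchange = solve 4 (λ a b c d → (a :+ b) :+ (c :+ d) := (a :+ c) :+ (b :+ d)) refl

module _ {n : ℕ} (p : Fin n → ℚ) where

  expect-cong : ∀ {X Y} → (∀ S → X S ≡ Y S) → expect p X ≡ expect p Y
  expect-cong X≗Y = ∑ˡ-cong (allSubsets n) (λ S → cong (prodProb p S *_) (X≗Y S))

  expect-+ : ∀ X Y → expect p (λ S → X S + Y S) ≡ expect p X + expect p Y
  expect-+ X Y = trans
    (∑ˡ-cong (allSubsets n) (λ S → *-distribˡ-+ (prodProb p S) (X S) (Y S)))
    (∑ˡ-distrib-+ (allSubsets n) _ _)

expect-suc : ∀ {n} (p : Fin (suc n) → ℚ) X →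
  expect p X ≡ p Fin.zero * expect (p ∘ Fin.suc) (X ∘ (true ∷_))
             + (1ℚ - p Fin.zero) * expect (p ∘ Fin.suc) (X ∘ (false ∷_))
expect-suc {n} p X = begin
  ∑ˡ (map (true ∷_) A ++ map (false ∷_) A) term
    ≡⟨ ∑ˡ-++ (map (true ∷_) A) _ term ⟩
  ∑ˡ (map (true ∷_) A) term + ∑ˡ (map (false ∷_) A) term
    ≡⟨ cong₂ _+_ (∑ˡ-map (true ∷_) A term) (∑ˡ-map (false ∷_) A term) ⟩
  ∑ˡ A (term ∘ (true ∷_)) + ∑ˡ A (term ∘ (false ∷_))
    ≡⟨ cong₂ _+_ (pull p₀ true) (pull (1ℚ - p₀) false) ⟩
  p₀ * expect p′ (X ∘ (true ∷_)) + (1ℚ - p₀) * expect p′ (X ∘ (false ∷_)) ∎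
  where
  open ≡-Reasoning
  A = allSubsets n
  p₀ = p Fin.zero
  p′ = p ∘ Fin.suc
  term = λ S → prodProb p S * X S
  pull : ∀ c b → ∑ˡ A (λ S → (c * prodProb p′ S) * X (b ∷ S)) ≡ c * expect p′ (X ∘ (b ∷_))
  pull c b = trans (∑ˡ-cong A (λ S → *-assoc c _ _)) (sym (*-distribˡ-∑ˡ c A _))

expect-const : ∀ {n} (p : Fin n → ℚ) c → expect p (λ _ → c) ≡ c
expect-const {zero}  p c = trans (+-identityʳ _) (*-identityˡ c)
expect-const {suc n} p c = begin
  expect p (λ _ → c)                                    ≡⟨ expect-suc p _ ⟩
  p₀ * expect p′ (λ _ → c) + (1ℚ - p₀) * expect p′ (λ _ → c)
    ≡⟨ cong (λ e → p₀ * e + (1ℚ - p₀) * e) (expect-const p′ c) ⟩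
  p₀ * c + (1ℚ - p₀) * c                                ≡⟨ split p₀ c ⟩
  c                                                     ∎
  where
  open ≡-Reasoning
  open +-*-Solver
  p₀ = p Fin.zero
  p′ = p ∘ Fin.suc
  split : ∀ x c → x * c + (1ℚ - x) * c ≡ c
  split = solve 2 (λ x c → x :* c :+ (con 1ℚ :- x) :* c := c) refl

expect-size : ∀ {n} (p : Fin n → ℚ) → expect p (λ S → toℚ ∣ S ∣) ≡ ℚΣ.sum p
expect-size {zero}  p = *-zeroʳ 1ℚ
expect-size {suc n} p = begin
  expect p size                                              ≡⟨ expect-suc p size ⟩
  p₀ * expect p′ (λ S → toℚ (1 +ℕ ∣ S ∣)) + (1ℚ - p₀) * expect p′ size
    ≡⟨ cong (λ e → p₀ * e + (1ℚ - p₀) * expect p′ size) (expect-cong p′ (λ S → toℚ-+ 1 ∣ S ∣)) ⟩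
  p₀ * expect p′ (λ S → 1ℚ + size S) + (1ℚ - p₀) * expect p′ size
    ≡⟨ cong (λ e → p₀ * e + (1ℚ - p₀) * expect p′ size)
         (trans (expect-+ p′ _ size) (cong (_+ expect p′ size) (expect-const p′ 1ℚ))) ⟩
  p₀ * (1ℚ + expect p′ size) + (1ℚ - p₀) * expect p′ size
    ≡⟨ cong (λ e → p₀ * (1ℚ + e) + (1ℚ - p₀) * e) (expect-size p′) ⟩
  p₀ * (1ℚ + ℚΣ.sum p′) + (1ℚ - p₀) * ℚΣ.sum p′             ≡⟨ collect p₀ _ ⟩
  p₀ + ℚΣ.sum p′                                             ∎
  where
  open ≡-Reasoning
  open +-*-Solver
  p₀ = p Fin.zero
  p′ = p ∘ Fin.suc
  size : ∀ {m} → Subset m → ℚ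
  size S = toℚ ∣ S ∣
  collect : ∀ x e → x * (1ℚ + e) + (1ℚ - x) * e ≡ x + e
  collect = solve 2 (λ x e → x :* (con 1ℚ :+ e) :+ (con 1ℚ :- x) :* e := x :+ e) refl

𝟙 : Bool → ℕ
𝟙 b = if b then 1 else 0

∣p∩q∣≡∑ : ∀ {n} (p q : Subset n) → ∣ p ∩ q ∣ ≡ ∑[ i < n ] (𝟙 (lookup p i) *ℕ 𝟙 (lookup q i))
∣p∩q∣≡∑ []          []          = refl
∣p∩q∣≡∑ (true ∷ p)  (true ∷ q)  = cong suc (∣p∩q∣≡∑ p q)
∣p∩q∣≡∑ (true ∷ p)  (false ∷ q) = ∣p∩q∣≡∑ p q
∣p∩q∣≡∑ (false ∷ p) (_ ∷ q)     = ∣p∩q∣≡∑ p q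

edgesBetween : ∀ {n} → Graph n → Subset n → Subset n → ℕ
edgesBetween {n} G U W = ∑[ u < n ] (𝟙 (lookup U u) *ℕ ∣ N G u ∩ W ∣)

edgesBetween-∑∑ : ∀ {n} (G : Graph n) U W → edgesBetween G U W
  ≡ ∑[ u < n ] ∑[ w < n ] (𝟙 (lookup U u) *ℕ (𝟙 (adj G u w) *ℕ 𝟙 (lookup W w)))
edgesBetween-∑∑ {n} G U W = sum-cong-≗ λ u → begin
  𝟙 (lookup U u) *ℕ ∣ N G u ∩ W ∣
    ≡⟨ cong (𝟙 (lookup U u) *ℕ_) (∣p∩q∣≡∑ (N G u) W) ⟩
  𝟙 (lookup U u) *ℕ (∑[ w < n ] (𝟙 (lookup (N G u) w) *ℕ 𝟙 (lookup W w)))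
    ≡⟨ *-distribˡ-sum {n} (𝟙 (lookup U u)) _ ⟩
  ∑[ w < n ] (𝟙 (lookup U u) *ℕ (𝟙 (lookup (N G u) w) *ℕ 𝟙 (lookup W w)))
    ≡⟨ sum-cong-≗ (λ w → cong (λ b → 𝟙 (lookup U u) *ℕ (𝟙 b *ℕ 𝟙 (lookup W w)))
                               (lookup∘tabulate (adj G u) w)) ⟩
  ∑[ w < n ] (𝟙 (lookup U u) *ℕ (𝟙 (adj G u w) *ℕ 𝟙 (lookup W w))) ∎
  where open ≡-Reasoning

edgesBetween-comm : ∀ {n} (G : Graph n) U W → edgesBetween G U W ≡ edgesBetween G W U
edgesBetween-comm {n} G U W = begin
  edgesBetween G U W
    ≡⟨ edgesBetween-∑∑ G U W ⟩
  ∑[ u < n ] ∑[ w < n ] (𝟙 (lookup U u) *ℕ (𝟙 (adj G u w) *ℕ 𝟙 (lookup W w)))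
    ≡⟨ ∑-comm {n} {n} _ ⟩
  ∑[ w < n ] ∑[ u < n ] (𝟙 (lookup U u) *ℕ (𝟙 (adj G u w) *ℕ 𝟙 (lookup W w)))
    ≡⟨ sum-cong-≗ (λ w → sum-cong-≗ (λ u → mirror (lookup U u) (adj G u w) (adj G w u)
                                                 (lookup W w) (Graph.sym G u w))) ⟩
  ∑[ w < n ] ∑[ u < n ] (𝟙 (lookup W w) *ℕ (𝟙 (adj G w u) *ℕ 𝟙 (lookup U u)))
    ≡⟨ edgesBetween-∑∑ G W U ⟨
  edgesBetween G W U ∎
  where
  open ≡-Reasoning
  mirror : ∀ a b b′ c → b ≡ b′ → 𝟙 a *ℕ (𝟙 b *ℕ 𝟙 c) ≡ 𝟙 c *ℕ (𝟙 b′ *ℕ 𝟙 a)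
  mirror a b _ c refl = begin
    𝟙 a *ℕ (𝟙 b *ℕ 𝟙 c)   ≡⟨ ℕ.*-comm (𝟙 a) _ ⟩
    (𝟙 b *ℕ 𝟙 c) *ℕ 𝟙 a   ≡⟨ cong (_*ℕ 𝟙 a) (ℕ.*-comm (𝟙 b) (𝟙 c)) ⟩
    (𝟙 c *ℕ 𝟙 b) *ℕ 𝟙 a   ≡⟨ ℕ.*-assoc (𝟙 c) (𝟙 b) (𝟙 a) ⟩
    𝟙 c *ℕ (𝟙 b *ℕ 𝟙 a)   ∎

∑-indicator-≤ : ∀ {n} (S : Subset n) (f : Fin n → ℕ) {Δ} → (∀ {i} → i ∈ S → toℚ (f i) ≤ Δ) →
  toℚ (∑[ i < n ] (𝟙 (lookup S i) *ℕ f i)) ≤ toℚ ∣ S ∣ * Δ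
∑-indicator-≤ []          f {Δ} f≤Δ = ≤-reflexive (sym (*-zeroˡ Δ))
∑-indicator-≤ (false ∷ S) f     f≤Δ = ∑-indicator-≤ S (f ∘ Fin.suc) (f≤Δ ∘ there)
∑-indicator-≤ {suc n} (true ∷ S) f {Δ} f≤Δ = begin
  toℚ (1 *ℕ f Fin.zero +ℕ rest)          ≡⟨ toℚ-+ (1 *ℕ f Fin.zero) rest ⟩
  toℚ (1 *ℕ f Fin.zero) + toℚ rest       ≡⟨ cong (λ m → toℚ m + toℚ rest) (ℕ.*-identityˡ (f Fin.zero)) ⟩
  toℚ (f Fin.zero) + toℚ rest            ≤⟨ +-mono-≤ (f≤Δ here) (∑-indicator-≤ S (f ∘ Fin.suc) (f≤Δ ∘ there)) ⟩
  Δ + toℚ ∣ S ∣ * Δ                      ≡⟨ cong (_+ toℚ ∣ S ∣ * Δ) (*-identityˡ Δ) ⟨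
  1ℚ * Δ + toℚ ∣ S ∣ * Δ                 ≡⟨ *-distribʳ-+ Δ 1ℚ (toℚ ∣ S ∣) ⟨
  (1ℚ + toℚ ∣ S ∣) * Δ                   ≡⟨ cong (_* Δ) (toℚ-+ 1 ∣ S ∣) ⟨
  toℚ (suc ∣ S ∣) * Δ                    ∎
  where
  open ≤-Reasoning
  rest = ∑[ i < n ] (𝟙 (lookup S i) *ℕ f (Fin.suc i))

module _ {n} (G : Graph n) (V' : Subset n) (Δ : ℚ) where

  Heavy⊆V' : Heavy G V' Δ ⊆ V'
  Heavy⊆V' {v} v∈H = lookup⇒[]= v V'
    (∧-conicalˡ _ _ (trans (sym (lookup∘tabulate _ v)) ([]=⇒lookup v∈H)))

  friendProb≡ : ∀ (1≤Δ : 1ℚ ≤ Δ) .{{_ : NonZero Δ}} v → friendProb G V' Δ 1≤Δ v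
    ≡ toℚ (𝟙 (lookup V' v) *ℕ ∣ N G v ∩ Heavy G V' Δ ∣) * ((+ 1 / 4) ÷ Δ)
  friendProb≡ 1≤Δ v = scaled (lookup V' v) ∣ N G v ∩ Heavy G V' Δ ∣
    where
    scaled : ∀ b c → (if b then (+ c / 4) ÷ Δ else 0ℚ) ≡ toℚ (𝟙 b *ℕ c) * ((+ 1 / 4) ÷ Δ)
    scaled false c = sym (*-zeroˡ ((+ 1 / 4) ÷ Δ))
    scaled true  c = begin
      (+ c / 4) * 1/ Δ                 ≡⟨ cong (_* 1/ Δ) (/4≡toℚ*¼ c) ⟩
      (toℚ c * (+ 1 / 4)) * 1/ Δ       ≡⟨ *-assoc (toℚ c) _ _ ⟩
      toℚ c * ((+ 1 / 4) * 1/ Δ)       ≡⟨ cong (λ m → toℚ m * ((+ 1 / 4) * 1/ Δ)) (ℕ.*-identityˡ c) ⟨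
      toℚ (1 *ℕ c) * ((+ 1 / 4) * 1/ Δ) ∎
      where open ≡-Reasoning

  expectedFriends≡edges : ∀ (1≤Δ : 1ℚ ≤ Δ) .{{_ : NonZero Δ}} →
    expectedFriends G V' Δ 1≤Δ ≡ toℚ (edgesBetween G (Heavy G V' Δ) V') * ((+ 1 / 4) ÷ Δ)
  expectedFriends≡edges 1≤Δ = begin
    expectedFriends G V' Δ 1≤Δ                  ≡⟨ expect-size p ⟩
    ℚΣ.sum p                                    ≡⟨ ℚΣ.sum-cong-≗ (friendProb≡ 1≤Δ) ⟩
    ℚΣ.sum (λ v → toℚ (a v) * q)                ≡⟨ ℚΣ.*-distribʳ-sum {n} q (toℚ ∘ a) ⟨
    ℚΣ.sum (toℚ ∘ a) * q                        ≡⟨ cong (_* q) (toℚ-sum a) ⟨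
    toℚ (edgesBetween G V' H) * q               ≡⟨ cong (λ e → toℚ e * q) (edgesBetween-comm G V' H) ⟩
    toℚ (edgesBetween G H V') * q               ∎
    where
    open ≡-Reasoning
    H = Heavy G V' Δ
    p = friendProb G V' Δ 1≤Δ
    q = (+ 1 / 4) ÷ Δ
    a = λ v → 𝟙 (lookup V' v) *ℕ ∣ N G v ∩ H ∣

  expectedFriends≤∣Heavy∣*¼ : ∀ (1≤Δ : 1ℚ ≤ Δ) → InducedMaxDegAtMost G V' Δ →
    expectedFriends G V' Δ 1≤Δ ≤ toℚ ∣ Heavy G V' Δ ∣ * (+ 1 / 4)
  expectedFriends≤∣Heavy∣*¼ 1≤Δ degV'≤Δ = begin
    expectedFriends G V' Δ 1≤Δ                ≡⟨ expectedFriends≡edges 1≤Δ ⟩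
    toℚ (edgesBetween G H V') * q             ≤⟨ *-monoʳ-≤-nonNeg q (∑-indicator-≤ H _ deg≤Δ) ⟩
    (toℚ ∣ H ∣ * Δ) * q                       ≡⟨ cancel (toℚ ∣ H ∣) ⟩
    toℚ ∣ H ∣ * (+ 1 / 4)                     ∎
    where
    open ≤-Reasoning
    open +-*-Solver
    H = Heavy G V' Δ
    instance
      Δ>0 : Positive Δ
      Δ>0 = positive (<-≤-trans (positive⁻¹ 1ℚ) 1≤Δ)
      Δ≢0 : NonZero Δ
      Δ≢0 = pos⇒nonZero Δ
      1/Δ≥0 : NonNegative (1/ Δ)
      1/Δ≥0 = pos⇒nonNeg (1/ Δ) {{1/pos⇒pos Δ}}
      q≥0 : NonNegative ((+ 1 / 4) ÷ Δ)
      q≥0 = nonNeg*nonNeg⇒nonNeg (+ 1 / 4) (1/ Δ)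
    q = (+ 1 / 4) ÷ Δ
    deg≤Δ : ∀ {h} → h ∈ H → toℚ ∣ N G h ∩ V' ∣ ≤ Δ
    deg≤Δ h∈H = degV'≤Δ _ (Heavy⊆V' h∈H)
    regroup : ∀ x d e c → (x * d) * (c * e) ≡ (x * c) * (d * e)
    regroup = solve 4 (λ x d e c → (x :* d) :* (c :* e) := (x :* c) :* (d :* e)) refl
    cancel : ∀ x → (x * Δ) * q ≡ x * (+ 1 / 4)
    cancel x = trans (regroup x Δ (1/ Δ) (+ 1 / 4))
      (trans (cong ((x * (+ 1 / 4)) *_) (*-inverseʳ Δ)) (*-identityʳ _))

lemma2 : ∀ {n} (G : Graph n) (Δ̃ : ℕ) → MaxDegAtMost G Δ̃ →
    (k : ℕ) (V' : Subset n) (1≤Δ : 1ℚ ≤ phaseΔ Δ̃ k) →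
    InducedMaxDegAtMost G V' (phaseΔ Δ̃ k) →
    expectedFriends G V' (phaseΔ Δ̃ k) 1≤Δ
    ≤ toℚ ∣ Heavy G V' (phaseΔ Δ̃ k) ∣ * (+ 1 / 4)
lemma2 G Δ̃ _ k V' = expectedFriends≤∣Heavy∣*¼ G V' (phaseΔ Δ̃ k)
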